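{- Let $G$ be a minimal non-weakly flat path extendable graph, let $P$ be a witness path for $G$ with witness sets $W_1,W_2$, and let $X$ be a cutset of $G$ such that $G[X\cap V(P)]$ is connected and $X\subseteq N[X\cap V(P)]$. Then every component of $G\setminus X$ contains a vertex adjacent to some vertex of $X\cap V(P)$.
   Context: A hole is an induced cycle with at least four vertices; chordal means no hole. A cutset of $G$ is a set $X$ with $G\setminus X$ disconnected; connected graphs are nonempty. For a vertex set or path $S$, $N[S]$ is the set of vertices in $S$ or with a neighbor in $S$. $G$ is weakly flat path extendable (weakly FPE) if for every path $P$ with one or two vertices and every two sets $W_1,W_2$ with $G[W_1],G[W_2]$ chordal, $W_1\cap W_2=V(P)$, $W_1\cup W_2=N[P]$, there exist $X_1\supseteq W_1$, $X_2\supseteq W_2$ with $G[X_1],G[X_2]$ chordal, $X_1\cap X_2=V(P)$, $X_1\cup X_2=V(G)$. $G$ is minimal non-weakly FPE if $G$ is not weakly FPE but every proper induced subgraph is weakly FPE. For such $G$, a witness path is a path $P$ with one or two vertices together with witness sets $W_1,W_2$ ($G[W_1],G[W_2]$ chordal, $W_1\cap W_2=V(P)$, $W_1\cup W_2=N[P]$) for which no such $X_1,X_2$ exist. -}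

module Defs where

open import Data.Nat using (ℕ; zero; suc; _+_; _%_)
open import Data.Bool using (Bool; true; false; _∧_; _∨_)
open import Data.Fin using (Fin; toℕ) renaming (zero to fzero; suc to fsuc)
open import Data.Fin.Subset using (Subset; _∈_; _⊆_; _⊂_; _∩_; _∪_; ∁; ⊤; Nonempty)
open import Data.Vec using (lookup; tabulate)
open import Data.Product using (Σ; _×_; _,_)
open import Data.Sum using (_⊎_)
open import Data.Empty using (⊥)
open import Relation.Binary.PropositionalEquality using (_≡_)
open import Function.Bundles using (_⇔_)
import Data.Fin
import Relation.Nullary

record Graph : Set where
  field
    n      : ℕ
    adj    : Fin n → Fin n → Bool
    sym    : ∀ x y → adj x y ≡ adj y x
    irrefl : ∀ x → adj x x ≡ false

module _ (G : Graph) where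
  open Graph G

  Adj : Fin n → Fin n → Set
  Adj x y = adj x y ≡ true

  anyFin : ∀ {m} → (Fin m → Bool) → Bool
  anyFin {zero}  f = false
  anyFin {suc m} f = f fzero ∨ anyFin (λ i → f (fsuc i))

  NbhdIn : Subset n → Subset n → Subset n
  NbhdIn U S = tabulate λ x →
    lookup U x ∧ (lookup S x ∨ anyFin (λ y → lookup U y ∧ lookup S y ∧ adj x y))

  Nbhd : Subset n → Subset n
  Nbhd S = NbhdIn ⊤ S

  CycAdj : ∀ {k} → Fin (suc k) → Fin (suc k) → Set
  CycAdj {k} i j = ((toℕ i + 1) % suc k ≡ toℕ j) ⊎ ((toℕ j + 1) % suc k ≡ toℕ i)

  record Hole (S : Subset n) : Set where
    field
      k     : ℕ
      c     : Fin (suc (suc (suc (suc k)))) → Fin n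
      inS   : ∀ i → c i ∈ S
      inj   : ∀ i j → c i ≡ c j → i ≡ j
      edges : ∀ i j → Adj (c i) (c j) ⇔ CycAdj i j

  Chordal : Subset n → Set
  Chordal S = Hole S → ⊥

  data SmallPath : Set where
    vert1 : Fin n → SmallPath
    vert2 : (u v : Fin n) → Adj u v → SmallPath

  VP : SmallPath → Subset n
  VP (vert1 v)     = tabulate λ x → isEq x v
    where
      isEq : Fin n → Fin n → Bool
      isEq x y with Data.Fin._≟_ x y
      ... | Relation.Nullary.yes _ = true
      ... | Relation.Nullary.no _  = false
  VP (vert2 u v _) = tabulate λ x → isEq x u ∨ isEq x v
    where
      isEq : Fin n → Fin n → Bool
      isEq x y with Data.Fin._≟_ x y
      ... | Relation.Nullary.yes _ = true
      ... | Relation.Nullary.no _  = false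

  Extends : Subset n → SmallPath → Subset n → Subset n → Set
  Extends U P W₁ W₂ = Σ (Subset n) λ X₁ → Σ (Subset n) λ X₂ →
    W₁ ⊆ X₁ × W₂ ⊆ X₂ × Chordal X₁ × Chordal X₂ ×
    X₁ ∩ X₂ ≡ VP P × X₁ ∪ X₂ ≡ U

  Admissible : Subset n → SmallPath → Subset n → Subset n → Set
  Admissible U P W₁ W₂ =
    Chordal W₁ × Chordal W₂ × W₁ ∩ W₂ ≡ VP P × W₁ ∪ W₂ ≡ NbhdIn U (VP P)

  WeaklyFPEOn : Subset n → Set
  WeaklyFPEOn U = ∀ (P : SmallPath) → VP P ⊆ U → ∀ (W₁ W₂ : Subset n) →
    Admissible U P W₁ W₂ → Extends U P W₁ W₂

  WeaklyFPE : Set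
  WeaklyFPE = WeaklyFPEOn ⊤

  MinimalNonWeaklyFPE : Set
  MinimalNonWeaklyFPE = (WeaklyFPE → ⊥) × (∀ U → U ⊂ ⊤ → WeaklyFPEOn U)

  WitnessPath : SmallPath → Subset n → Subset n → Set
  WitnessPath P W₁ W₂ = Admissible ⊤ P W₁ W₂ × (Extends ⊤ P W₁ W₂ → ⊥)

  data Reach (S : Subset n) : Fin n → Fin n → Set where
    here : ∀ {x} → x ∈ S → Reach S x x
    step : ∀ {x z y} → x ∈ S → Adj x z → Reach S z y → Reach S x y

  Connected : Subset n → Set
  Connected S = Nonempty S × (∀ x y → x ∈ S → y ∈ S → Reach S x y)

  Cutset : Subset n → Set
  Cutset X = Connected (∁ X) → ⊥

  Component : Subset n → Subset n → Set
  Component S C = C ⊆ S × Connected C ×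
    (∀ D → C ⊆ D → D ⊆ S → Connected D → D ≡ C)

-- Suppose a component C of G ∖ X has no neighbour in R = X ∩ V(P). As V(P) is a clique meeting X,
-- C also avoids N[P], so W₁, W₂ are admissible in G ∖ C and minimality extends them to chordal
-- Y₁, Y₂ covering G ∖ C. The subpath Q of P on R dominates X, so Y₁ ∩ X, Y₂ ∩ X are admissible
-- for Q in G[C ∪ X], a proper subgraph because X is a cutset; minimality extends them to Z₁, Z₂.
-- Then Y₁ ∪ Z₁, Y₂ ∪ Z₂ extend W₁, W₂ in G, contradicting that P is a witness path: a hole of
-- Yᵢ ∪ Zᵢ inside neither part must cross C along an induced path between two nonadjacent vertices
-- of X, and closing that path through Q (a common neighbour, or an edge of Q) is a hole of Zᵢ.

module Submission where

open import Defs
open import Data.Nat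
  using (ℕ; zero; suc; _+_; _∸_; _≤_; _<_; _≤?_; _<?_; z≤n; s≤s; NonZero; _%_)
open import Data.Nat.Properties hiding (_≟_)
open import Data.Nat.DivMod using (_mod_; m%n<n; m<n⇒m%n≡m; m≤n⇒[n∸m]%m≡n%m; n%n≡0; [m+n]%n≡m%n; %-distribˡ-+)
open import Data.Bool using (Bool; true; false; _∧_; _∨_)
open import Data.Bool.Properties using (∨-zeroʳ; ∧-conicalˡ; ∧-conicalʳ)
open import Data.Fin using (Fin; toℕ; _≟_) renaming (zero to fzero; suc to fsuc)
open import Data.Fin.Properties using (toℕ-injective; toℕ<n; toℕ-fromℕ<; ¬∀⟶∃¬; any?; all?)
open import Data.Fin.Subset using (Subset; _∈_; _∉_; _⊆_; _⊂_; _∩_; _∪_; ∁; ⊤; ⁅_⁆; Nonempty)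
open import Data.Fin.Subset.Properties
  using (_∈?_; ∈⊤; ⊆-antisym; x∈p∩q⁺; x∈p∩q⁻; x∈p∪q⁺; x∈p∪q⁻; x∈∁p⇒x∉p; x∈p⇒x∉∁p; x∉p⇒x∈∁p;
         x∈⁅x⁆; x∈⁅y⁆⇒x≡y; p∩q⊆p)
open import Data.Vec using (lookup; tabulate)
open import Data.Vec.Properties using (lookup∘tabulate; []=⇒lookup; lookup⇒[]=)
open import Data.Product using (Σ; ∃-syntax; _×_; _,_; proj₁; proj₂)
open import Data.Sum using (_⊎_; inj₁; inj₂; [_,_]′)
import Data.Sum
open import Data.Empty using (⊥-elim)
open import Relation.Nullary using (¬_; Dec; yes; no; contradiction)
open import Relation.Nullary.Decidable using (_×-dec_)
open import Relation.Binary.Definitions using (tri<; tri≈; tri>)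
open import Relation.Binary.PropositionalEquality
  using (_≡_; _≢_; refl; sym; trans; cong; subst; subst₂; module ≡-Reasoning)
open import Function.Bundles using (_⇔_; mk⇔; Equivalence)
open import Function.Base using (_∋_; _∘_)

resolve-inj₂ : ∀ {a b} {A : Set a} {B : Set b} → ¬ A → A ⊎ B → B
resolve-inj₂ ¬a = [ (λ a → contradiction a ¬a) , (λ b → b) ]′

resolve-inj₁ : ∀ {a b} {A : Set a} {B : Set b} → ¬ B → A ⊎ B → A
resolve-inj₁ ¬b = [ (λ a → a) , (λ b → contradiction b ¬b) ]′

∨-true⁻ : ∀ a {b} → a ∨ b ≡ true → a ≡ true ⊎ b ≡ true
∨-true⁻ true  _ = inj₁ refl
∨-true⁻ false h = inj₂ h

∨-trueˡ : ∀ {a} b → a ≡ true → a ∨ b ≡ true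
∨-trueˡ _ refl = refl

∨-trueʳ : ∀ a {b} → b ≡ true → a ∨ b ≡ true
∨-trueʳ a refl = ∨-zeroʳ a

∧-true⁻ : ∀ a {b} → a ∧ b ≡ true → a ≡ true × b ≡ true
∧-true⁻ a {b} h = ∧-conicalˡ a b h , ∧-conicalʳ a b h

∧-true⁺ : ∀ {a b} → a ≡ true → b ≡ true → a ∧ b ≡ true
∧-true⁺ refl refl = refl

module _ {n : ℕ} where

  ∈⇒lookup : ∀ {x : Fin n} {S} → x ∈ S → lookup S x ≡ true
  ∈⇒lookup = []=⇒lookup

  lookup⇒∈ : ∀ {x : Fin n} {S} → lookup S x ≡ true → x ∈ S
  lookup⇒∈ {x} {S} = lookup⇒[]= x S

  ∈-tabulate⁻ : ∀ {f : Fin n → Bool} {x} → x ∈ tabulate f → f x ≡ true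
  ∈-tabulate⁻ {f} {x} h = trans (sym (lookup∘tabulate f x)) ([]=⇒lookup h)

  ∈-tabulate⁺ : ∀ {f : Fin n → Bool} {x} → f x ≡ true → x ∈ tabulate f
  ∈-tabulate⁺ {f} {x} h = lookup⇒[]= x _ (trans (lookup∘tabulate f x) h)

  x∈p∪q∧x∉p⇒x∈q : ∀ {x} {p q : Subset n} → x ∈ p ∪ q → x ∉ p → x ∈ q
  x∈p∪q∧x∉p⇒x∈q {p = p} {q} h x∉p = resolve-inj₂ x∉p (x∈p∪q⁻ p q h)

  x∈p∪q∧x∉q⇒x∈p : ∀ {x} {p q : Subset n} → x ∈ p ∪ q → x ∉ q → x ∈ p
  x∈p∪q∧x∉q⇒x∈p {p = p} {q} h x∉q = resolve-inj₁ x∉q (x∈p∪q⁻ p q h)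

[r+d]%n≢r : ∀ {r d n} .{{_ : NonZero n}} → r < n → 0 < d → d < n → (r + d) % n ≢ r
[r+d]%n≢r {r} {d} {n} r<n 0<d d<n eq with r + d <? n
... | yes r+d<n = >⇒≢ (m<m+n r 0<d) (trans (sym (m<n⇒m%n≡m r+d<n)) eq)
... | no r+d≮n = <⇒≢ d<n (+-cancelˡ-≡ r d n (begin
      r + d          ≡⟨ m∸n+n≡m n≤r+d ⟨
      r + d ∸ n + n  ≡⟨ cong (_+ n) wrapped ⟩
      r + n          ∎))
  where
    open ≡-Reasoning
    n≤r+d : n ≤ r + d
    n≤r+d = ≮⇒≥ r+d≮n
    r+d∸n<n : r + d ∸ n < n
    r+d∸n<n = subst (r + d ∸ n <_) (m+n∸n≡m n n) (∸-monoˡ-< (+-mono-< r<n d<n) n≤r+d)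
    wrapped : r + d ∸ n ≡ r
    wrapped = trans (sym (m<n⇒m%n≡m r+d∸n<n)) (trans (m≤n⇒[n∸m]%m≡n%m n≤r+d) eq)

[m+d]%n≢m%n : ∀ m {d n} .{{_ : NonZero n}} → 0 < d → d < n → (m + d) % n ≢ m % n
[m+d]%n≢m%n m {d} {n} 0<d d<n eq = [r+d]%n≢r (m%n<n m n) 0<d d<n (begin
  (m % n + d) % n      ≡⟨ cong (λ z → (m % n + z) % n) (m<n⇒m%n≡m d<n) ⟨
  (m % n + d % n) % n  ≡⟨ %-distribˡ-+ m d n ⟨
  (m + d) % n          ≡⟨ eq ⟩
  m % n                ∎)
  where open ≡-Reasoning

[m%n+1]%n≡[m+1]%n : ∀ m {n} .{{_ : NonZero n}} → 1 < n → (m % n + 1) % n ≡ (m + 1) % n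
[m%n+1]%n≡[m+1]%n m {n} 1<n =
  trans (cong (λ z → (m % n + z) % n) (sym (m<n⇒m%n≡m 1<n))) (sym (%-distribˡ-+ m 1 n))

[m+1]%n≡k⇔ : ∀ {m k n} .{{_ : NonZero n}} → m < n → k < n →
  (m + 1) % n ≡ k ⇔ (suc m ≡ k ⊎ (suc m ≡ n × k ≡ 0))
[m+1]%n≡k⇔ {m} {k} {n} m<n k<n = mk⇔ to from
  where
    to : (m + 1) % n ≡ k → suc m ≡ k ⊎ (suc m ≡ n × k ≡ 0)
    to eq with suc m <? n
    ... | yes 1+m<n = inj₁ (trans (sym (m<n⇒m%n≡m 1+m<n)) (trans (cong (_% n) (+-comm 1 m)) eq))
    ... | no 1+m≮n = inj₂ (1+m≡n , trans (sym eq) (trans (cong (_% n) (trans (+-comm m 1) 1+m≡n)) (n%n≡0 n)))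
      where
        1+m≡n : suc m ≡ n
        1+m≡n = ≤-antisym m<n (≮⇒≥ 1+m≮n)
    from : suc m ≡ k ⊎ (suc m ≡ n × k ≡ 0) → (m + 1) % n ≡ k
    from (inj₁ refl)        = trans (cong (_% n) (+-comm m 1)) (m<n⇒m%n≡m k<n)
    from (inj₂ (1+m≡n , refl)) = trans (cong (_% n) (trans (+-comm m 1) 1+m≡n)) (n%n≡0 n)

m<n⇒n≡1+m⊎2+m≤n : ∀ {m n} → m < n → n ≡ suc m ⊎ 2 + m ≤ n
m<n⇒n≡1+m⊎2+m≤n m<n = Data.Sum.swap (Data.Sum.map₂ sym (m≤n⇒m<n∨m≡n m<n))

window-gap : ∀ {o a b P} → o < a → a < b → suc b < o + P →
  ∃[ D ] (suc b ≡ a + D × 2 ≤ D × 2 + D ≤ P)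
window-gap {o} {a} {b} {P} o<a a<b 1+b<o+P with m≤n⇒∃[o]m+o≡n (≤-trans (<⇒≤ a<b) (n≤1+n b))
... | D , a+D≡1+b = D , sym a+D≡1+b , 2≤D , +-cancelˡ-≤ o (2 + D) P o+[2+D]≤o+P
  where
    2≤D : 2 ≤ D
    2≤D = +-cancelˡ-≤ a 2 D (subst₂ _≤_ (+-comm 2 a) (sym a+D≡1+b) (s≤s a<b))
    o+[2+D]≤o+P : o + (2 + D) ≤ o + P
    o+[2+D]≤o+P = begin
      o + suc (suc D)   ≡⟨ +-suc o (suc D) ⟩
      suc o + suc D     ≤⟨ +-monoˡ-≤ (suc D) o<a ⟩
      a + suc D         ≡⟨ +-suc a D ⟩
      suc (a + D)       ≡⟨ cong suc a+D≡1+b ⟩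
      suc (suc b)       ≤⟨ 1+b<o+P ⟩
      o + P             ∎
      where open ≤-Reasoning

-- Maximal runs of a decidable predicate

module _ {p} {P : ℕ → Set p} (P? : ∀ t → Dec (P t)) where

  last-failure : ∀ {o} J → o ≤ J → ¬ P o →
    ∃[ a ] (o ≤ a × a ≤ J × ¬ P a × (∀ t → a < t → t ≤ J → P t))
  last-failure J o≤J ¬Po with P? J
  ... | no ¬PJ = J , o≤J , ≤-refl , ¬PJ , λ t J<t t≤J → contradiction t≤J (<⇒≱ J<t)
  last-failure zero z≤n ¬P0 | yes P0 = contradiction P0 ¬P0
  last-failure (suc J) o≤1+J ¬Po | yes P1+J with m≤n⇒m<n∨m≡n o≤1+J
  ... | inj₂ refl = contradiction P1+J ¬Po
  ... | inj₁ o<1+J with last-failure J (≤-pred o<1+J) ¬Po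
  ...   | a , o≤a , a≤J , ¬Pa , after = a , o≤a , m≤n⇒m≤1+n a≤J , ¬Pa , after′
    where
      after′ : ∀ t → a < t → t ≤ suc J → P t
      after′ t a<t t≤1+J = [ (λ t<1+J → after t a<t (≤-pred t<1+J)) , (λ { refl → P1+J }) ]′
                             (m≤n⇒m<n∨m≡n t≤1+J)

  first-failure : ∀ d J → ¬ P (d + J) →
    ∃[ b ] (J ≤ b × b ≤ d + J × ¬ P b × (∀ t → J ≤ t → t < b → P t))
  first-failure d J ¬Pd+J with P? J
  ... | no ¬PJ = J , ≤-refl , m≤n+m J d , ¬PJ , λ t J≤t t<J → contradiction J≤t (<⇒≱ t<J)
  first-failure zero J ¬PJ | yes PJ = contradiction PJ ¬PJ
  first-failure (suc d) J ¬Pd+J | yes PJ with first-failure d (suc J) (subst (¬_ ∘ P) (sym (+-suc d J)) ¬Pd+J)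
  ... | b , J<b , b≤ , ¬Pb , before = b , <⇒≤ J<b , subst (b ≤_) (+-suc d J) b≤ , ¬Pb , before′
    where
      before′ : ∀ t → J ≤ t → t < b → P t
      before′ t J≤t t<b = [ (λ J<t → before t J<t t<b) , (λ { refl → PJ }) ]′ (m≤n⇒m<n∨m≡n J≤t)

  maximal-run : ∀ {o J e} → o ≤ J → J ≤ e → ¬ P o → ¬ P e → P J →
    ∃[ a ] ∃[ b ] (o ≤ a × a < J × J < b × b ≤ e × ¬ P a × ¬ P b × (∀ t → a < t → t < b → P t))
  maximal-run {o} {J} {e} o≤J J≤e ¬Po ¬Pe PJ
    with last-failure J o≤J ¬Po | first-failure (e ∸ J) J (subst (¬_ ∘ P) (sym (m∸n+n≡m J≤e)) ¬Pe)
  ... | a , o≤a , a≤J , ¬Pa , after | b , J≤b , b≤ , ¬Pb , before =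
    a , b , o≤a , a<J , J<b , subst (b ≤_) (m∸n+n≡m J≤e) b≤ , ¬Pa , ¬Pb , inside
    where
      a<J : a < J
      a<J = ≤∧≢⇒< a≤J (λ { refl → ¬Pa PJ })
      J<b : J < b
      J<b = ≤∧≢⇒< J≤b (λ { refl → ¬Pb PJ })
      inside : ∀ t → a < t → t < b → P t
      inside t a<t t<b with t ≤? J
      ... | yes t≤J = after t a<t t≤J
      ... | no t≰J  = before t (<⇒≤ (≰⇒> t≰J)) t<b

module _ (G : Graph) where
  open Graph G using (n; adj; irrefl) renaming (sym to adj-sym)

  Adj-sym : ∀ {x y} → Adj G x y → Adj G y x
  Adj-sym {x} {y} h = trans (adj-sym y x) h

  Adj-irrefl : ∀ {x} → ¬ Adj G x x
  Adj-irrefl {x} h with trans (sym h) (irrefl x)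
  ... | ()

  Adj⇒≢ : ∀ {x y} → Adj G x y → x ≢ y
  Adj⇒≢ h refl = Adj-irrefl h

  Adj? : ∀ x y → Dec (Adj G x y)
  Adj? x y with adj x y
  ... | true  = yes refl
  ... | false = no λ ()

  anyFin⁻ : ∀ {m} (f : Fin m → Bool) → anyFin G f ≡ true → ∃[ y ] f y ≡ true
  anyFin⁻ {suc m} f h with ∨-true⁻ (f fzero) h
  ... | inj₁ f0 = fzero , f0
  ... | inj₂ fs with anyFin⁻ (λ i → f (fsuc i)) fs
  ...   | y , fy = fsuc y , fy

  anyFin⁺ : ∀ {m} (f : Fin m → Bool) y → f y ≡ true → anyFin G f ≡ true
  anyFin⁺ f fzero     h = ∨-trueˡ _ h
  anyFin⁺ f (fsuc y) h = ∨-trueʳ (f fzero) (anyFin⁺ (λ i → f (fsuc i)) y h)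

  NeighbourIn : Subset n → Subset n → Fin n → Set
  NeighbourIn U S x = ∃[ y ] y ∈ U × y ∈ S × Adj G x y

  ∈NbhdIn⁻ : ∀ U S {x} → x ∈ NbhdIn G U S → x ∈ U × (x ∈ S ⊎ NeighbourIn U S x)
  ∈NbhdIn⁻ U S {x} h with ∧-true⁻ (lookup U x) (∈-tabulate⁻ h)
  ... | x∈U , near with ∨-true⁻ (lookup S x) near
  ...   | inj₁ x∈S = lookup⇒∈ x∈U , inj₁ (lookup⇒∈ x∈S)
  ...   | inj₂ any with anyFin⁻ _ any
  ...     | y , yUSx with ∧-true⁻ (lookup U y) yUSx
  ...       | y∈U , ySx with ∧-true⁻ (lookup S y) ySx
  ...         | y∈S , xy = lookup⇒∈ x∈U , inj₂ (y , lookup⇒∈ y∈U , lookup⇒∈ y∈S , xy)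

  ∈NbhdIn⁺ : ∀ {U S x} → x ∈ U → x ∈ S ⊎ NeighbourIn U S x → x ∈ NbhdIn G U S
  ∈NbhdIn⁺ x∈U (inj₁ x∈S) = ∈-tabulate⁺ (∧-true⁺ (∈⇒lookup x∈U) (∨-trueˡ _ (∈⇒lookup x∈S)))
  ∈NbhdIn⁺ {U} {S} {x} x∈U (inj₂ (y , y∈U , y∈S , xy)) =
    ∈-tabulate⁺ (∧-true⁺ (∈⇒lookup x∈U) (∨-trueʳ (lookup S x)
      (anyFin⁺ _ y (∧-true⁺ (∈⇒lookup y∈U) (∧-true⁺ (∈⇒lookup y∈S) xy)))))

  NbhdIn-mono : ∀ {U U′ S} → U ⊆ U′ → NbhdIn G U S ⊆ NbhdIn G U′ S
  NbhdIn-mono {U} {U′} {S} U⊆U′ v∈ with ∈NbhdIn⁻ U S v∈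
  ... | v∈U , inj₁ v∈S = ∈NbhdIn⁺ (U⊆U′ v∈U) (inj₁ v∈S)
  ... | v∈U , inj₂ (w , w∈U , w∈S , vw) = ∈NbhdIn⁺ (U⊆U′ v∈U) (inj₂ (w , U⊆U′ w∈U , w∈S , vw))

  Nbhd-restrict : ∀ {U S v} → S ⊆ U → v ∈ U → v ∈ Nbhd G S → v ∈ NbhdIn G U S
  Nbhd-restrict {U} {S} S⊆U v∈U v∈ with ∈NbhdIn⁻ ⊤ S v∈
  ... | _ , inj₁ v∈S = ∈NbhdIn⁺ v∈U (inj₁ v∈S)
  ... | _ , inj₂ (w , _ , w∈S , vw) = ∈NbhdIn⁺ v∈U (inj₂ (w , S⊆U w∈S , w∈S , vw))

  ∈VP-vert1⁻ : ∀ {v x} → x ∈ VP G (vert1 v) → x ≡ v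
  ∈VP-vert1⁻ {v} {x} h with x ≟ v | ∈-tabulate⁻ h
  ... | yes x≡v | _ = x≡v
  ... | no _    | ()

  ∈VP-vert1⁺ : ∀ {v} → v ∈ VP G (vert1 v)
  ∈VP-vert1⁺ {v} with v ≟ v | (lookup (VP G (vert1 v)) v ≡ _ ∋ lookup∘tabulate _ v)
  ... | yes _  | eq = lookup⇒∈ eq
  ... | no v≢v | _  = ⊥-elim (v≢v refl)

  ∈VP-vert2⁻ : ∀ {u v} e {x} → x ∈ VP G (vert2 u v e) → x ≡ u ⊎ x ≡ v
  ∈VP-vert2⁻ {u} {v} e {x} h
    with x ≟ u | x ≟ v | (lookup (VP G (vert2 u v e)) x ≡ _ ∋ lookup∘tabulate _ x)
  ... | yes x≡u | _       | _  = inj₁ x≡u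
  ... | no _    | yes x≡v | _  = inj₂ x≡v
  ... | no _    | no _    | eq with trans (sym eq) (∈⇒lookup h)
  ...   | ()

  ∈VP-vert2⁺ : ∀ {u v} e {x} → x ≡ u ⊎ x ≡ v → x ∈ VP G (vert2 u v e)
  ∈VP-vert2⁺ {u} {v} e {x} x≡
    with x ≟ u | x ≟ v | (lookup (VP G (vert2 u v e)) x ≡ _ ∋ lookup∘tabulate _ x)
  ... | yes _   | _     | eq = lookup⇒∈ eq
  ... | no _    | yes _ | eq = lookup⇒∈ eq
  ... | no x≢u  | no x≢v | _ = ⊥-elim ([ x≢u , x≢v ]′ x≡)

  Clique : Subset n → Set
  Clique K = ∀ {a b} → a ∈ K → b ∈ K → a ≢ b → Adj G a b

  VP-clique : ∀ P → Clique (VP G P)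
  VP-clique (vert1 v) x∈ y∈ x≢y = ⊥-elim (x≢y (trans (∈VP-vert1⁻ x∈) (sym (∈VP-vert1⁻ y∈))))
  VP-clique (vert2 u v e) x∈ y∈ x≢y with ∈VP-vert2⁻ e x∈ | ∈VP-vert2⁻ e y∈
  ... | inj₁ refl | inj₁ refl = ⊥-elim (x≢y refl)
  ... | inj₁ refl | inj₂ refl = e
  ... | inj₂ refl | inj₁ refl = Adj-sym e
  ... | inj₂ refl | inj₂ refl = ⊥-elim (x≢y refl)

  VP-∩ : ∀ P {X} → VP G P ⊆ X → VP G P ≡ X ∩ VP G P
  VP-∩ P P⊆X = ⊆-antisym (λ x∈ → x∈p∩q⁺ (P⊆X x∈ , x∈)) (λ {x} x∈ → proj₂ (x∈p∩q⁻ _ _ x∈))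

  SmallPath-∩ : ∀ P (X : Subset n) → Nonempty (X ∩ VP G P) → ∃[ Q ] VP G Q ≡ X ∩ VP G P
  SmallPath-∩ (vert1 v) X (r , r∈) = vert1 v , VP-∩ (vert1 v) v∈X
    where
      v∈X : VP G (vert1 v) ⊆ X
      v∈X x∈ with x∈p∩q⁻ X _ r∈
      ... | r∈X , r∈P = subst (_∈ X) (trans (∈VP-vert1⁻ r∈P) (sym (∈VP-vert1⁻ x∈))) r∈X
  SmallPath-∩ (vert2 u v e) X (r , r∈) with u ∈? X | v ∈? X
  ... | yes u∈X | yes v∈X =
    vert2 u v e , VP-∩ (vert2 u v e) λ x∈ → [ (λ { refl → u∈X }) , (λ { refl → v∈X }) ]′ (∈VP-vert2⁻ e x∈)
  ... | yes u∈X | no v∉X = vert1 u , ⊆-antisym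
         (λ x∈ → subst (_∈ X ∩ _) (sym (∈VP-vert1⁻ x∈)) (x∈p∩q⁺ (u∈X , ∈VP-vert2⁺ e (inj₁ refl))))
         (λ x∈ → case (x∈p∩q⁻ X _ x∈))
    where
      case : ∀ {x} → x ∈ X × x ∈ VP G (vert2 u v e) → x ∈ VP G (vert1 u)
      case (x∈X , x∈P) with ∈VP-vert2⁻ e x∈P
      ... | inj₁ refl = ∈VP-vert1⁺
      ... | inj₂ refl = contradiction x∈X v∉X
  ... | no u∉X | yes v∈X = vert1 v , ⊆-antisym
         (λ x∈ → subst (_∈ X ∩ _) (sym (∈VP-vert1⁻ x∈)) (x∈p∩q⁺ (v∈X , ∈VP-vert2⁺ e (inj₂ refl))))
         (λ x∈ → case (x∈p∩q⁻ X _ x∈))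
    where
      case : ∀ {x} → x ∈ X × x ∈ VP G (vert2 u v e) → x ∈ VP G (vert1 v)
      case (x∈X , x∈P) with ∈VP-vert2⁻ e x∈P
      ... | inj₁ refl = contradiction x∈X u∉X
      ... | inj₂ refl = ∈VP-vert1⁺
  ... | no u∉X | no v∉X with x∈p∩q⁻ X _ r∈
  ...   | r∈X , r∈P = ⊥-elim ([ (λ { refl → u∉X r∈X }) , (λ { refl → v∉X r∈X }) ]′ (∈VP-vert2⁻ e r∈P))

  Reach-mono : ∀ {S T x y} → S ⊆ T → Reach G S x y → Reach G T x y
  Reach-mono S⊆T (here x∈)       = here (S⊆T x∈)
  Reach-mono S⊆T (step x∈ xz zy) = step (S⊆T x∈) xz (Reach-mono S⊆T zy)

  Reach-trans : ∀ {S x y z} → Reach G S x y → Reach G S y z → Reach G S x z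
  Reach-trans (here _)         yz = yz
  Reach-trans (step x∈ xw wy) yz = step x∈ xw (Reach-trans wy yz)

  Component-closed : ∀ {S C c w} → Component G S C → c ∈ C → w ∈ S → Adj G c w → w ∈ C
  Component-closed {S} {C} {c} {w} (C⊆S , (_ , conn) , maximal) c∈C w∈S cw =
    subst (w ∈_) (maximal D (x∈p∪q⁺ ∘ inj₁) D⊆S ((w , w∈D) , D-conn)) w∈D
    where
      D : Subset n
      D = C ∪ ⁅ w ⁆
      w∈D : w ∈ D
      w∈D = x∈p∪q⁺ (inj₂ (x∈⁅x⁆ w))
      C⊆D : C ⊆ D
      C⊆D x∈ = x∈p∪q⁺ (inj₁ x∈)
      split : ∀ {x} → x ∈ D → x ∈ C ⊎ x ≡ w
      split x∈ = Data.Sum.map₂ (x∈⁅y⁆⇒x≡y w) (x∈p∪q⁻ C _ x∈)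
      D⊆S : D ⊆ S
      D⊆S x∈ = [ C⊆S , (λ { refl → w∈S }) ]′ (split x∈)
      to-c : ∀ {x} → x ∈ D → Reach G D x c
      to-c x∈ with split x∈
      ... | inj₁ x∈C = Reach-mono C⊆D (conn _ _ x∈C c∈C)
      ... | inj₂ refl = step w∈D (Adj-sym cw) (here (C⊆D c∈C))
      from-c : ∀ {y} → y ∈ D → Reach G D c y
      from-c y∈ with split y∈
      ... | inj₁ y∈C = Reach-mono C⊆D (conn _ _ c∈C y∈C)
      ... | inj₂ refl = step (C⊆D c∈C) cw (here w∈D)
      D-conn : ∀ x y → x ∈ D → y ∈ D → Reach G D x y
      D-conn _ _ x∈ y∈ = Reach-trans (to-c x∈) (from-c y∈)

  Hole-narrow : ∀ {S T} (H : Hole G S) → (∀ i → Hole.c H i ∈ T) → Hole G T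
  Hole-narrow H c∈T = record { k = k ; c = c ; inS = c∈T ; inj = inj ; edges = edges }
    where open Hole H

  Chordal-anti : ∀ {S T} → S ⊆ T → Chordal G T → Chordal G S
  Chordal-anti S⊆T chT H = chT (Hole-narrow H (λ i → S⊆T (Hole.inS H i)))

-- Holes as induced cycles and concatenations of induced paths

  record InducedCycle (S : Subset n) : Set where
    field
      len       : ℕ
      vtx       : ℕ → Fin n
      long      : 4 ≤ len
      ∈S        : ∀ i → i < len → vtx i ∈ S
      distinct  : ∀ i j → i < j → j < len → vtx i ≢ vtx j
      adjacent  : ∀ i → suc i < len → Adj G (vtx i) (vtx (suc i))
      closing   : ∀ i → suc i ≡ len → Adj G (vtx i) (vtx 0)
      chordless : ∀ i j → i < j → j < len → Adj G (vtx i) (vtx j) →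
                  j ≡ suc i ⊎ (i ≡ 0 × suc j ≡ len)

  InducedCycle⇒Hole : ∀ {S} → InducedCycle S → Hole G S
  InducedCycle⇒Hole {S} C with m≤n⇒∃[o]m+o≡n (InducedCycle.long C)
  ... | k , 4+k≡len = record
    { k = k ; c = c ; inS = λ i → ∈S (toℕ i) (bound i) ; inj = inj ; edges = edges }
    where
      open InducedCycle C
      c : Fin (4 + k) → Fin n
      c i = vtx (toℕ i)
      bound : ∀ (i : Fin (4 + k)) → toℕ i < len
      bound i = subst (toℕ i <_) 4+k≡len (toℕ<n i)
      fit : ∀ {a} → a < len → a < 4 + k
      fit = subst (_ <_) (sym 4+k≡len)
      inj : ∀ i j → c i ≡ c j → i ≡ j
      inj i j ci≡cj with <-cmp (toℕ i) (toℕ j)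
      ... | tri< i<j _ _ = contradiction ci≡cj (distinct _ _ i<j (bound j))
      ... | tri≈ _ i≡j _ = toℕ-injective i≡j
      ... | tri> _ _ j<i = contradiction (sym ci≡cj) (distinct _ _ j<i (bound i))
      cycle-step : ∀ {a b} → a < len → b < len → (a + 1) % (4 + k) ≡ b → Adj G (vtx a) (vtx b)
      cycle-step a< b< eq with Equivalence.to ([m+1]%n≡k⇔ (fit a<) (fit b<)) eq
      ... | inj₁ refl = adjacent _ b<
      ... | inj₂ (1+a≡ , refl) = closing _ (trans 1+a≡ 4+k≡len)
      forward : ∀ {a b} → a < len → b < len → a < b → Adj G (vtx a) (vtx b) →
                (a + 1) % (4 + k) ≡ b ⊎ (b + 1) % (4 + k) ≡ a
      forward a< b< a<b ab with chordless _ _ a<b b< ab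
      ... | inj₁ b≡1+a = inj₁ (Equivalence.from ([m+1]%n≡k⇔ (fit a<) (fit b<)) (inj₁ (sym b≡1+a)))
      ... | inj₂ (a≡0 , 1+b≡len) =
        inj₂ (Equivalence.from ([m+1]%n≡k⇔ (fit b<) (fit a<)) (inj₂ (trans 1+b≡len (sym 4+k≡len) , a≡0)))
      edges : ∀ i j → Adj G (c i) (c j) ⇔ CycAdj G i j
      edges i j = mk⇔ to from
        where
          to : Adj G (c i) (c j) → CycAdj G i j
          to ij with <-cmp (toℕ i) (toℕ j)
          ... | tri< i<j _ _ = forward (bound i) (bound j) i<j ij
          ... | tri≈ _ i≡j _ = contradiction (subst (λ z → Adj G (c i) (vtx z)) (sym i≡j) ij) Adj-irrefl
          ... | tri> _ _ j<i = Data.Sum.swap (forward (bound j) (bound i) j<i (Adj-sym ij))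
          from : CycAdj G i j → Adj G (c i) (c j)
          from (inj₁ eq) = cycle-step (bound i) (bound j) eq
          from (inj₂ eq) = Adj-sym (cycle-step (bound j) (bound i) eq)

  record InducedPath (S : Subset n) (x y : Fin n) : Set where
    field
      len       : ℕ
      vtx       : ℕ → Fin n
      start     : vtx 0 ≡ x
      end       : vtx len ≡ y
      interior  : ∀ i → 0 < i → i < len → vtx i ∈ S
      distinct  : ∀ i j → i < j → j ≤ len → vtx i ≢ vtx j
      adjacent  : ∀ i → i < len → Adj G (vtx i) (vtx (suc i))
      chordless : ∀ i j → 2 + i ≤ j → j ≤ len → ¬ Adj G (vtx i) (vtx j)

    2≤len : x ≢ y → ¬ Adj G x y → 2 ≤ len
    2≤len x≢y ¬xy with len in eq
    ... | 0     = contradiction (trans (sym start) (trans (cong vtx (sym eq)) end)) x≢y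
    ... | 1     = contradiction (subst₂ (Adj G) start (trans (cong vtx (sym eq)) end)
                                  (adjacent 0 (subst (0 <_) (sym eq) (s≤s z≤n)))) ¬xy
    ... | suc (suc _) = s≤s (s≤s z≤n)

    vtx-∈ : ∀ {Z} → S ⊆ Z → x ∈ Z → y ∈ Z → ∀ i → i ≤ len → vtx i ∈ Z
    vtx-∈ S⊆Z x∈Z y∈Z zero _ = subst (_∈ _) (sym start) x∈Z
    vtx-∈ S⊆Z x∈Z y∈Z (suc i) i< with m≤n⇒m<n∨m≡n i<
    ... | inj₁ 1+i<len = S⊆Z (interior (suc i) (s≤s z≤n) 1+i<len)
    ... | inj₂ 1+i≡len = subst (_∈ _) (sym (trans (cong vtx 1+i≡len) end)) y∈Z

    endpoints-distinct : 0 < len → x ≢ y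
    endpoints-distinct 0<len x≡y = distinct 0 len 0<len ≤-refl (trans start (trans x≡y (sym end)))

    endpoints-nonadjacent : 2 ≤ len → ¬ Adj G x y
    endpoints-nonadjacent 2≤len xy = chordless 0 len 2≤len ≤-refl (subst₂ (Adj G) (sym start) (sym end) xy)

  path₂ : ∀ {K y w x} → w ∈ K → Adj G y w → Adj G w x → y ≢ x → ¬ Adj G y x → InducedPath K y x
  path₂ {K} {y} {w} {x} w∈K yw wx y≢x ¬yx = record
    { len = 2 ; vtx = vtx ; start = refl ; end = refl ; interior = interior
    ; distinct = distinct ; adjacent = adjacent ; chordless = chordless }
    where
      vtx : ℕ → Fin n
      vtx 0 = y
      vtx 1 = w
      vtx _ = x
      interior : ∀ i → 0 < i → i < 2 → vtx i ∈ K
      interior 1 _ _ = w∈K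
      interior (suc (suc _)) _ (s≤s (s≤s ()))
      distinct : ∀ i j → i < j → j ≤ 2 → vtx i ≢ vtx j
      distinct 0 1 _ _ = Adj⇒≢ yw
      distinct 0 2 _ _ = y≢x
      distinct 1 2 _ _ = Adj⇒≢ wx
      distinct _ (suc (suc (suc _))) _ (s≤s (s≤s ()))
      distinct (suc _) 1 (s≤s ()) _
      distinct (suc (suc _)) 2 (s≤s (s≤s ())) _
      adjacent : ∀ i → i < 2 → Adj G (vtx i) (vtx (suc i))
      adjacent 0 _ = yw
      adjacent 1 _ = wx
      adjacent (suc (suc _)) (s≤s (s≤s ()))
      chordless : ∀ i j → 2 + i ≤ j → j ≤ 2 → ¬ Adj G (vtx i) (vtx j)
      chordless 0 2 _ _ = ¬yx
      chordless _ (suc (suc (suc _))) _ (s≤s (s≤s ()))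
      chordless _ 1 (s≤s ()) _
      chordless (suc _) 2 (s≤s (s≤s ())) _

  path₃ : ∀ {K y v u x} → v ∈ K → u ∈ K → Adj G y v → Adj G v u → Adj G u x →
          y ≢ u → y ≢ x → v ≢ x → ¬ Adj G y u → ¬ Adj G y x → ¬ Adj G v x → InducedPath K y x
  path₃ {K} {y} {v} {u} {x} v∈K u∈K yv vu ux y≢u y≢x v≢x ¬yu ¬yx ¬vx = record
    { len = 3 ; vtx = vtx ; start = refl ; end = refl ; interior = interior
    ; distinct = distinct ; adjacent = adjacent ; chordless = chordless }
    where
      vtx : ℕ → Fin n
      vtx 0 = y
      vtx 1 = v
      vtx 2 = u
      vtx _ = x
      interior : ∀ i → 0 < i → i < 3 → vtx i ∈ K
      interior 1 _ _ = v∈K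
      interior 2 _ _ = u∈K
      interior (suc (suc (suc _))) _ (s≤s (s≤s (s≤s ())))
      distinct : ∀ i j → i < j → j ≤ 3 → vtx i ≢ vtx j
      distinct 0 1 _ _ = Adj⇒≢ yv
      distinct 0 2 _ _ = y≢u
      distinct 0 3 _ _ = y≢x
      distinct 1 2 _ _ = Adj⇒≢ vu
      distinct 1 3 _ _ = v≢x
      distinct 2 3 _ _ = Adj⇒≢ ux
      distinct _ (suc (suc (suc (suc _)))) _ (s≤s (s≤s (s≤s ())))
      distinct (suc _) 1 (s≤s ()) _
      distinct (suc (suc _)) 2 (s≤s (s≤s ())) _
      distinct (suc (suc (suc _))) 3 (s≤s (s≤s (s≤s ()))) _
      adjacent : ∀ i → i < 3 → Adj G (vtx i) (vtx (suc i))
      adjacent 0 _ = yv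
      adjacent 1 _ = vu
      adjacent 2 _ = ux
      adjacent (suc (suc (suc _))) (s≤s (s≤s (s≤s ())))
      chordless : ∀ i j → 2 + i ≤ j → j ≤ 3 → ¬ Adj G (vtx i) (vtx j)
      chordless 0 2 _ _ = ¬yu
      chordless 0 3 _ _ = ¬yx
      chordless 1 3 _ _ = ¬vx
      chordless _ (suc (suc (suc (suc _)))) _ (s≤s (s≤s (s≤s ())))
      chordless _ 1 (s≤s ()) _
      chordless (suc _) 2 (s≤s (s≤s ())) _
      chordless (suc (suc _)) 3 (s≤s (s≤s (s≤s ()))) _

  -- Without a common neighbour in K, neither x nor y lies in K and their neighbours in K differ.
  clique-path : ∀ {K x y} → Clique K → x ∈ Nbhd G K → y ∈ Nbhd G K → x ≢ y → ¬ Adj G x y →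
                InducedPath K y x
  clique-path {K} {x} {y} clique x∈N y∈N x≢y ¬xy with any? (λ w → w ∈? K ×-dec (Adj? w x ×-dec Adj? w y))
  ... | yes (w , w∈K , wx , wy) = path₂ w∈K (Adj-sym wy) wx (x≢y ∘ sym) (¬xy ∘ Adj-sym)
  ... | no ¬common = join (neighbour x∈N x∉K) (neighbour y∈N y∉K)
    where
      common : ∀ {w} → w ∈ K → Adj G w x → ¬ Adj G w y
      common w∈K wx wy = ¬common (_ , w∈K , wx , wy)
      outside : ∀ {s t} → t ∈ Nbhd G K → s ≢ t → ¬ Adj G s t →
                (∀ {w} → w ∈ K → Adj G w s → ¬ Adj G w t) → s ∉ K
      outside {s} t∈N s≢t ¬st no-common s∈K with proj₂ (∈NbhdIn⁻ ⊤ K t∈N)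
      ... | inj₁ t∈K = ¬st (clique s∈K t∈K s≢t)
      ... | inj₂ (w , _ , w∈K , tw) with w ≟ s
      ...   | yes refl = ¬st (Adj-sym tw)
      ...   | no w≢s   = no-common w∈K (clique w∈K s∈K w≢s) (Adj-sym tw)
      x∉K : x ∉ K
      x∉K = outside y∈N x≢y ¬xy common
      y∉K : y ∉ K
      y∉K = outside x∈N (x≢y ∘ sym) (¬xy ∘ Adj-sym) (λ w∈K wy wx → common w∈K wx wy)
      neighbour : ∀ {s} → s ∈ Nbhd G K → s ∉ K → ∃[ w ] w ∈ K × Adj G s w
      neighbour s∈N s∉K with proj₂ (∈NbhdIn⁻ ⊤ K s∈N)
      ... | inj₁ s∈K = contradiction s∈K s∉K
      ... | inj₂ (w , _ , w∈K , sw) = w , w∈K , sw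
      join : ∃[ a ] a ∈ K × Adj G x a → ∃[ b ] b ∈ K × Adj G y b → InducedPath K y x
      join (a , a∈K , xa) (b , b∈K , yb) with a ≟ b
      ... | yes refl = ⊥-elim (common a∈K (Adj-sym xa) (Adj-sym yb))
      ... | no a≢b = path₃ b∈K a∈K yb (clique b∈K a∈K (a≢b ∘ sym)) (Adj-sym xa)
                       (λ { refl → y∉K a∈K }) (x≢y ∘ sym) (λ { refl → x∉K b∈K })
                       (λ ya → common a∈K (Adj-sym xa) (Adj-sym ya)) (¬xy ∘ Adj-sym)
                       (λ bx → common b∈K bx (Adj-sym yb))

  module HoleSequence {S} (H : Hole G S) where
    open Hole H

    -- Reading the hole periodically along ℕ makes each of its stretches an interval.

    period : ℕ
    period = 4 + k

    at : ℕ → Fin n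
    at t = c (t mod period)

    toℕ-mod : ∀ t → toℕ (t mod period) ≡ t % period
    toℕ-mod t = toℕ-fromℕ< (m%n<n t period)

    at-∈ : ∀ t → at t ∈ S
    at-∈ t = inS (t mod period)

    at-toℕ : ∀ i → at (toℕ i) ≡ c i
    at-toℕ i = cong c (toℕ-injective (trans (toℕ-mod (toℕ i)) (m<n⇒m%n≡m (toℕ<n i))))

    at-periodic : ∀ t → at (t + period) ≡ at t
    at-periodic t = cong c (toℕ-injective (begin
      toℕ ((t + period) mod period)  ≡⟨ toℕ-mod (t + period) ⟩
      (t + period) % period          ≡⟨ [m+n]%n≡m%n t period ⟩
      t % period                     ≡⟨ toℕ-mod t ⟨
      toℕ (t mod period)             ∎))
      where open ≡-Reasoning

    at-Adj⇔ : ∀ s t → Adj G (at s) (at t) ⇔ ((s + 1) % period ≡ t % period ⊎ (t + 1) % period ≡ s % period)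
    at-Adj⇔ s t = mk⇔
      (Data.Sum.map (λ e → trans (sym (shift s)) (trans e (toℕ-mod t)))
                    (λ e → trans (sym (shift t)) (trans e (toℕ-mod s)))
        ∘ Equivalence.to (edges _ _))
      (Equivalence.from (edges _ _) ∘
        Data.Sum.map (λ e → trans (shift s) (trans e (sym (toℕ-mod t))))
                     (λ e → trans (shift t) (trans e (sym (toℕ-mod s)))))
      where
        shift : ∀ r → (toℕ (r mod period) + 1) % period ≡ (r + 1) % period
        shift r = trans (cong (λ z → (z + 1) % period) (toℕ-mod r)) ([m%n+1]%n≡[m+1]%n r (s≤s (s≤s z≤n)))

    at-adjacent : ∀ t → Adj G (at t) (at (suc t))
    at-adjacent t = Equivalence.from (at-Adj⇔ t (suc t)) (inj₁ (cong (_% period) (+-comm t 1)))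

    at-nonadjacent : ∀ t d → 2 ≤ d → 2 + d ≤ period → ¬ Adj G (at t) (at (t + d))
    at-nonadjacent t 0 () _
    at-nonadjacent t 1 (s≤s ()) _
    at-nonadjacent t d@(suc (suc d′)) _ 2+d≤ adj with Equivalence.to (at-Adj⇔ t (t + d)) adj
    ... | inj₁ e = [m+d]%n≢m%n (t + 1) (s≤s z≤n) (<⇒≤ (<⇒≤ 2+d≤))
                     (sym (trans e (cong (_% period) (sym (+-assoc t 1 (suc d′))))))
    ... | inj₂ e = [m+d]%n≢m%n t (s≤s z≤n) 2+d≤
                     (trans (cong (_% period) (sym (trans (+-assoc t d 1) (cong (t +_) (+-comm d 1))))) e)

    at-distinct : ∀ t d → 0 < d → d < period → at t ≢ at (t + d)
    at-distinct t d 0<d d< eq = [m+d]%n≢m%n t 0<d d<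
      (trans (sym (toℕ-mod (t + d))) (trans (cong toℕ (sym (inj _ _ eq))) (toℕ-mod t)))

    segment : ∀ {T} a D → 2 + D ≤ period → (∀ i → 0 < i → i < D → at (a + i) ∈ T) →
              InducedPath T (at a) (at (a + D))
    segment {T} a D 2+D≤ inner = record
      { len = D ; vtx = λ i → at (a + i) ; start = cong at (+-identityʳ a) ; end = refl
      ; interior = inner ; distinct = distinct ; adjacent = adjacent ; chordless = chordless }
      where
        gap : ∀ {i j} → i ≤ j → ∃[ e ] (i + e ≡ j × a + j ≡ a + i + e)
        gap {i} i≤j with m≤n⇒∃[o]m+o≡n i≤j
        ... | e , refl = e , refl , sym (+-assoc a i e)
        distinct : ∀ i j → i < j → j ≤ D → at (a + i) ≢ at (a + j)
        distinct i j i<j j≤D with gap (<⇒≤ i<j)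
        ... | e , refl , a+j≡ = λ eq → at-distinct (a + i) e
                                  (+-cancelˡ-< i 0 e (subst (_< i + e) (sym (+-identityʳ i)) i<j))
                                  (≤-<-trans (≤-trans (m≤n+m e i) j≤D) (<⇒≤ 2+D≤))
                                  (trans eq (cong at a+j≡))
        adjacent : ∀ i → i < D → Adj G (at (a + i)) (at (a + suc i))
        adjacent i _ = subst (λ z → Adj G (at (a + i)) (at z)) (sym (+-suc a i)) (at-adjacent (a + i))
        chordless : ∀ i j → 2 + i ≤ j → j ≤ D → ¬ Adj G (at (a + i)) (at (a + j))
        chordless i j 2+i≤j j≤D with gap (≤-trans (m≤n+m i 2) 2+i≤j)
        ... | e , refl , a+j≡ = λ adj → at-nonadjacent (a + i) e
                                  (+-cancelˡ-≤ i 2 e (subst (_≤ i + e) (+-comm 2 i) 2+i≤j))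
                                  (≤-trans (+-monoʳ-≤ 2 (≤-trans (m≤n+m e i) j≤D)) 2+D≤)
                                  (subst (λ z → Adj G (at (a + i)) (at z)) a+j≡ adj)

  module Concatenation {A B Z : Subset n} {x y : Fin n}
    (p : InducedPath A x y) (q : InducedPath B y x)
    (A⊆Z : A ⊆ Z) (B⊆Z : B ⊆ Z) (x∈Z : x ∈ Z) (y∈Z : y ∈ Z) (x≢y : x ≢ y) (¬xy : ¬ Adj G x y)
    (A∩B≡∅ : ∀ {v} → v ∈ A → v ∉ B) (A-B : ∀ {a b} → a ∈ A → b ∈ B → ¬ Adj G a b) where

    private
      module p = InducedPath p
      module q = InducedPath q

      ℓ m : ℕ
      ℓ = p.len
      m = q.len

      x-join : q.vtx m ≡ p.vtx 0
      x-join = trans q.end (sym p.start)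

      2≤ℓ : 2 ≤ ℓ
      2≤ℓ = p.2≤len x≢y ¬xy

      2≤m : 2 ≤ m
      2≤m = q.2≤len (x≢y ∘ sym) (¬xy ∘ Adj-sym)

      y-join : p.vtx ℓ ≡ q.vtx 0
      y-join = trans p.end (sym q.start)

      h : ℕ → Fin n
      h i with i <? ℓ
      ... | yes _ = p.vtx i
      ... | no _  = q.vtx (i ∸ ℓ)

      h-left : ∀ {i} → i ≤ ℓ → h i ≡ p.vtx i
      h-left {i} i≤ℓ with i <? ℓ
      ... | yes _   = refl
      ... | no i≮ℓ  = trans (cong q.vtx (m≤n⇒m∸n≡0 i≤ℓ))
                        (trans (sym y-join) (cong p.vtx (sym (≤-antisym i≤ℓ (≮⇒≥ i≮ℓ)))))

      h-right : ∀ t → h (ℓ + t) ≡ q.vtx t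
      h-right t with ℓ + t <? ℓ
      ... | yes ℓ+t<ℓ = contradiction ℓ+t<ℓ (≤⇒≯ (m≤m+n ℓ t))
      ... | no _      = cong q.vtx (m+n∸m≡n ℓ t)

      data Side : ℕ → Set where
        left  : ∀ {i} → i < ℓ → Side i
        right : ∀ t → Side (ℓ + t)

      side : ∀ i → Side i
      side i with i <? ℓ
      ... | yes i<ℓ = left i<ℓ
      ... | no i≮ℓ  = subst Side (m+[n∸m]≡n (≮⇒≥ i≮ℓ)) (right (i ∸ ℓ))

      right-bound : ∀ {t} → ℓ + t < ℓ + m → t < m
      right-bound = +-cancelˡ-< ℓ _ _

      cross-distinct : ∀ i t → i < ℓ → t < m → p.vtx i ≢ q.vtx t
      cross-distinct zero    t       _   t<m eq = q.distinct t m t<m ≤-refl (trans (sym eq) (sym x-join))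
      cross-distinct (suc i) zero    i<ℓ _   eq = p.distinct (suc i) ℓ i<ℓ ≤-refl (trans eq (sym y-join))
      cross-distinct (suc i) (suc t) i<ℓ t<m eq =
        A∩B≡∅ (p.interior (suc i) (s≤s z≤n) i<ℓ) (subst (_∈ B) (sym eq) (q.interior (suc t) (s≤s z≤n) t<m))

      cross-chordless : ∀ i t → i < ℓ → t < m → Adj G (p.vtx i) (q.vtx t) →
                        ℓ + t ≡ suc i ⊎ (i ≡ 0 × suc (ℓ + t) ≡ ℓ + m)
      cross-chordless zero t _ t<m adj with m<n⇒n≡1+m⊎2+m≤n t<m
      ... | inj₁ m≡1+t = inj₂ (refl , trans (sym (+-suc ℓ t)) (cong (ℓ +_) (sym m≡1+t)))
      ... | inj₂ 2+t≤m = contradiction (subst (Adj G (q.vtx t)) (sym x-join) (Adj-sym adj))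
                                       (q.chordless t m 2+t≤m ≤-refl)
      cross-chordless (suc i) zero i<ℓ _ adj with m<n⇒n≡1+m⊎2+m≤n i<ℓ
      ... | inj₁ ℓ≡2+i = inj₁ (trans (+-identityʳ ℓ) ℓ≡2+i)
      ... | inj₂ 3+i≤ℓ = contradiction (subst (Adj G (p.vtx (suc i))) (sym y-join) adj)
                                       (p.chordless (suc i) ℓ 3+i≤ℓ ≤-refl)
      cross-chordless (suc i) (suc t) i<ℓ t<m adj =
        contradiction adj (A-B (p.interior (suc i) (s≤s z≤n) i<ℓ) (q.interior (suc t) (s≤s z≤n) t<m))

      distinct : ∀ i j → i < j → j < ℓ + m → h i ≢ h j
      distinct i j i<j j< with side i | side j
      ... | left i<ℓ | left j<ℓ = λ eq → p.distinct i j i<j (<⇒≤ j<ℓ)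
                                     (trans (sym (h-left (<⇒≤ i<ℓ))) (trans eq (h-left (<⇒≤ j<ℓ))))
      ... | left i<ℓ | right t  = λ eq → cross-distinct i t i<ℓ (right-bound j<)
                                     (trans (sym (h-left (<⇒≤ i<ℓ))) (trans eq (h-right t)))
      ... | right s  | left j<ℓ = contradiction (<-trans (≤-<-trans (m≤m+n ℓ s) i<j) j<ℓ) (<-irrefl refl)
      ... | right s  | right t  = λ eq → q.distinct s t (+-cancelˡ-< ℓ s t i<j) (<⇒≤ (right-bound j<))
                                     (trans (sym (h-right s)) (trans eq (h-right t)))

      adjacent : ∀ i → suc i < ℓ + m → Adj G (h i) (h (suc i))
      adjacent i 1+i< with side i
      ... | left i<ℓ = subst₂ (Adj G) (sym (h-left (<⇒≤ i<ℓ))) (sym (h-left i<ℓ)) (p.adjacent i i<ℓ)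
      ... | right t  = subst₂ (Adj G) (sym (h-right t))
                         (sym (trans (cong h (sym (+-suc ℓ t))) (h-right (suc t))))
                         (q.adjacent t (right-bound (<-trans (n<1+n (ℓ + t)) 1+i<)))

      closing : ∀ i → suc i ≡ ℓ + m → Adj G (h i) (h 0)
      closing i 1+i≡ with side i
      ... | left i<ℓ = contradiction (subst (_≤ ℓ) 1+i≡ i<ℓ) (<⇒≱ (m<m+n ℓ (≤-trans (s≤s z≤n) 2≤m)))
      ... | right t  = subst₂ (Adj G) (sym (h-right t))
                         (trans (cong q.vtx 1+t≡m) (trans x-join (sym (h-left z≤n))))
                         (q.adjacent t (subst (t <_) 1+t≡m ≤-refl))
        where
          1+t≡m : suc t ≡ m
          1+t≡m = +-cancelˡ-≡ ℓ (suc t) m (trans (+-suc ℓ t) 1+i≡)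

      chordless : ∀ i j → i < j → j < ℓ + m → Adj G (h i) (h j) → j ≡ suc i ⊎ (i ≡ 0 × suc j ≡ ℓ + m)
      chordless i j i<j j< adj with side i | side j
      ... | left i<ℓ | left j<ℓ with m<n⇒n≡1+m⊎2+m≤n i<j
      ...   | inj₁ j≡1+i = inj₁ j≡1+i
      ...   | inj₂ 2+i≤j = contradiction (subst₂ (Adj G) (h-left (<⇒≤ i<ℓ)) (h-left (<⇒≤ j<ℓ)) adj)
                                         (p.chordless i j 2+i≤j (<⇒≤ j<ℓ))
      chordless i _ _ j< adj | left i<ℓ | right t =
        cross-chordless i t i<ℓ (right-bound j<) (subst₂ (Adj G) (h-left (<⇒≤ i<ℓ)) (h-right t) adj)
      chordless _ j i<j _ _ | right s | left j<ℓ =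
        contradiction (<-trans (≤-<-trans (m≤m+n ℓ s) i<j) j<ℓ) (<-irrefl refl)
      chordless _ _ i<j j< adj | right s | right t with m<n⇒n≡1+m⊎2+m≤n (+-cancelˡ-< ℓ s t i<j)
      ... | inj₁ t≡1+s = inj₁ (trans (cong (ℓ +_) t≡1+s) (+-suc ℓ s))
      ... | inj₂ 2+s≤t = contradiction (subst₂ (Adj G) (h-right s) (h-right t) adj)
                                       (q.chordless s t 2+s≤t (<⇒≤ (right-bound j<)))

      ∈Z : ∀ i → i < ℓ + m → h i ∈ Z
      ∈Z i i< with side i
      ... | left i<ℓ = subst (_∈ Z) (sym (h-left (<⇒≤ i<ℓ))) (p.vtx-∈ A⊆Z x∈Z y∈Z i (<⇒≤ i<ℓ))
      ... | right t  = subst (_∈ Z) (sym (h-right t)) (q.vtx-∈ B⊆Z y∈Z x∈Z t (<⇒≤ (right-bound i<)))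

    cycle : InducedCycle Z
    cycle = record
      { len = ℓ + m ; vtx = h
      ; long = +-mono-≤ 2≤ℓ 2≤m
      ; ∈S = ∈Z ; distinct = distinct ; adjacent = adjacent ; closing = closing ; chordless = chordless }

-- Gluing chordal graphs across a cutset

  module Gluing {C X K : Subset n}
    (C-closed : ∀ {c w} → c ∈ C → Adj G c w → w ∈ C ⊎ w ∈ X)
    (K∩C≡∅ : ∀ {v} → v ∈ K → v ∉ C)
    (C-K : ∀ {c v} → c ∈ C → v ∈ K → ¬ Adj G c v)
    (join : ∀ {x y} → x ∈ X → y ∈ X → x ≢ y → ¬ Adj G x y → InducedPath K y x)
    {Y Z : Subset n}
    (Y∩C≡∅ : ∀ {v} → v ∈ Y → v ∉ C) (Z⊆C∪X : ∀ {v} → v ∈ Z → v ∈ C ⊎ v ∈ X)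
    (Y∩X⊆Z : ∀ {v} → v ∈ Y → v ∈ X → v ∈ Z) (Z∩X⊆Y : ∀ {v} → v ∈ Z → v ∈ X → v ∈ Y)
    (K⊆Z : K ⊆ Z) (chordal-Y : Chordal G Y) (chordal-Z : Chordal G Z) where

    private
      C-in-Z : ∀ {v} → v ∈ Y ∪ Z → v ∈ C → v ∈ Z
      C-in-Z v∈ v∈C = x∈p∪q∧x∉p⇒x∈q v∈ (λ v∈Y → Y∩C≡∅ v∈Y v∈C)

      X-in-Z : ∀ {v} → v ∈ Y ∪ Z → v ∈ X → v ∈ Z
      X-in-Z v∈ v∈X = [ (λ v∈Y → Y∩X⊆Z v∈Y v∈X) , (λ v∈Z → v∈Z) ]′ (x∈p∪q⁻ _ _ v∈)

      outside-C-in-Y : ∀ {v} → v ∈ Y ∪ Z → v ∉ C → v ∈ Y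
      outside-C-in-Y v∈ v∉C =
        [ (λ v∈Y → v∈Y) , (λ v∈Z → Z∩X⊆Y v∈Z (resolve-inj₂ v∉C (Z⊆C∪X v∈Z))) ]′ (x∈p∪q⁻ _ _ v∈)

      module Excursion (H : Hole G (Y ∪ Z)) {o : Fin (4 + Hole.k H)} (co∉Z : Hole.c H o ∉ Z) where
        open Hole H
        open HoleSequence H

        co∈Y : c o ∈ Y
        co∈Y = x∈p∪q∧x∉q⇒x∈p (inS o) co∉Z

        at-o∉X : at (toℕ o) ∉ X
        at-o∉X at-o∈X = co∉Z (Y∩X⊆Z co∈Y (subst (_∈ X) (at-toℕ o) at-o∈X))

        at-o∉C : at (toℕ o) ∉ C
        at-o∉C at-o∈C = Y∩C≡∅ co∈Y (subst (_∈ C) (at-toℕ o) at-o∈C)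

        crossing-hole : ∀ a D → 2 ≤ D → 2 + D ≤ period → at a ∈ X → at (a + D) ∈ X →
                        (∀ i → 0 < i → i < D → at (a + i) ∈ C) → Hole G Z
        crossing-hole a D 2≤D 2+D≤ a∈X a+D∈X inner = InducedCycle⇒Hole (Concatenation.cycle
            p (join a∈X a+D∈X x≢y ¬xy) (λ v∈ → proj₂ (x∈p∩q⁻ _ _ v∈)) K⊆Z
            (X-in-Z (at-∈ a) a∈X) (X-in-Z (at-∈ (a + D)) a+D∈X) x≢y ¬xy
            (λ v∈ v∈K → K∩C≡∅ v∈K (proj₁ (x∈p∩q⁻ _ _ v∈))) (λ v∈ → C-K (proj₁ (x∈p∩q⁻ _ _ v∈))))
          where
            p : InducedPath (C ∩ Z) (at a) (at (a + D))
            p = segment a D 2+D≤ λ i 0<i i<D →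
                  x∈p∩q⁺ (inner i 0<i i<D , C-in-Z (at-∈ (a + i)) (inner i 0<i i<D))
            x≢y : at a ≢ at (a + D)
            x≢y = InducedPath.endpoints-distinct p (≤-trans (s≤s z≤n) 2≤D)
            ¬xy : ¬ Adj G (at a) (at (a + D))
            ¬xy = InducedPath.endpoints-nonadjacent p 2≤D

        from-run : ∀ a b → toℕ o ≤ a → a < b → suc b ≤ toℕ o + period → at a ∉ C → at (suc b) ∉ C →
                   (∀ t → a < t → t < suc b → at t ∈ C) → Hole G Z
        from-run a b o≤a a<b 1+b≤ a∉C 1+b∉C inside = finish (window-gap o<a a<b 1+b<)
          where
            a∈X : at a ∈ X
            a∈X = resolve-inj₂ a∉C (C-closed (inside (suc a) ≤-refl (s≤s a<b)) (Adj-sym (at-adjacent a)))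
            1+b∈X : at (suc b) ∈ X
            1+b∈X = resolve-inj₂ 1+b∉C (C-closed (inside b a<b ≤-refl) (at-adjacent b))
            o<a : toℕ o < a
            o<a = ≤∧≢⇒< o≤a (λ { refl → at-o∉X a∈X })
            1+b< : suc b < toℕ o + period
            1+b< = ≤∧≢⇒< 1+b≤ (λ eq → at-o∉X (subst (_∈ X) (trans (cong at eq) (at-periodic (toℕ o))) 1+b∈X))
            finish : ∃[ D ] (suc b ≡ a + D × 2 ≤ D × 2 + D ≤ period) → Hole G Z
            finish (D , 1+b≡a+D , 2≤D , 2+D≤) = crossing-hole a D 2≤D 2+D≤ a∈X
              (subst (λ t → at t ∈ X) 1+b≡a+D 1+b∈X)
              (λ i 0<i i<D → inside (a + i) (m<m+n a 0<i) (subst (a + i <_) (sym 1+b≡a+D) (+-monoʳ-< a i<D)))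

        window : ∀ j → ∃[ J ] (toℕ o ≤ J × J ≤ toℕ o + period × at J ≡ c j)
        window j with toℕ o ≤? toℕ j
        ... | yes o≤j = toℕ j , o≤j , ≤-trans (<⇒≤ (toℕ<n j)) (m≤n+m period (toℕ o)) , at-toℕ j
        ... | no o≰j  = toℕ j + period , ≤-trans (<⇒≤ (toℕ<n o)) (m≤n+m period (toℕ j))
                      , +-monoˡ-≤ period (<⇒≤ (≰⇒> o≰j)) , trans (at-periodic (toℕ j)) (at-toℕ j)

        excursion : ∀ j → c j ∈ C → Hole G Z
        excursion j cj∈C with window j
        ... | J , o≤J , J≤ , atJ≡cj
            with maximal-run (λ t → at t ∈? C) o≤J J≤ at-o∉C
                   (λ e → at-o∉C (subst (_∈ C) (at-periodic (toℕ o)) e)) (subst (_∈ C) (sym atJ≡cj) cj∈C)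
        ...   | a , suc b , o≤a , a<J , J<1+b , 1+b≤ , a∉C , 1+b∉C , inside =
                from-run a b o≤a (<-≤-trans a<J (≤-pred J<1+b)) 1+b≤ a∉C 1+b∉C inside

    chordal-∪ : Chordal G (Y ∪ Z)
    chordal-∪ H with all? (λ i → Hole.c H i ∈? Z)
    ... | yes all∈Z = chordal-Z (Hole-narrow H all∈Z)
    ... | no ¬all∈Z with ¬∀⟶∃¬ _ _ (λ i → Hole.c H i ∈? Z) ¬all∈Z | any? (λ i → Hole.c H i ∈? C)
    ...   | o , co∉Z | yes (j , cj∈C) = chordal-Z (Excursion.excursion H co∉Z j cj∈C)
    ...   | _        | no ¬C          =
            chordal-Y (Hole-narrow H (λ i → outside-C-in-Y (Hole.inS H i) (λ ci∈C → ¬C (i , ci∈C))))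

-- A component with no neighbour in X ∩ V(P)

  module UnattachedComponent (P : SmallPath G) {W₁ W₂ X C : Subset n}
    (minimal : ∀ U → U ⊂ ⊤ → WeaklyFPEOn G U)
    (chordal-W₁ : Chordal G W₁) (chordal-W₂ : Chordal G W₂)
    (W₁∩W₂ : W₁ ∩ W₂ ≡ VP G P) (W₁∪W₂ : W₁ ∪ W₂ ≡ Nbhd G (VP G P))
    (cut : Cutset G X) (R≢∅ : Nonempty (X ∩ VP G P)) (X⊆N[R] : X ⊆ Nbhd G (X ∩ VP G P))
    (component : Component G (∁ X) C)
    (C-R : ∀ {c r} → c ∈ C → r ∈ X ∩ VP G P → ¬ Adj G c r) where

    private
      R : Subset n
      R = X ∩ VP G P

      C⊆∁X : C ⊆ ∁ X
      C⊆∁X = proj₁ component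

      C≢∅ : Nonempty C
      C≢∅ = proj₁ (proj₁ (proj₂ component))

      C∩X≡∅ : ∀ {v} → v ∈ C → v ∉ X
      C∩X≡∅ v∈C = x∈∁p⇒x∉p (C⊆∁X v∈C)

      C-closed : ∀ {c w} → c ∈ C → Adj G c w → w ∈ C ⊎ w ∈ X
      C-closed {w = w} c∈C cw with w ∈? X
      ... | yes w∈X = inj₂ w∈X
      ... | no w∉X  = inj₁ (Component-closed component c∈C (x∉p⇒x∈∁p w∉X) cw)

      VP∩C≡∅ : ∀ {v} → v ∈ VP G P → v ∉ C
      VP∩C≡∅ {v} v∈P v∈C with x∈p∩q⁻ X _ (proj₂ R≢∅)
      ... | r∈X , r∈P = C-R v∈C (proj₂ R≢∅) (VP-clique P v∈P r∈P (λ { refl → C∩X≡∅ v∈C r∈X }))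

      C-VP : ∀ {c v} → c ∈ C → v ∈ VP G P → ¬ Adj G c v
      C-VP c∈C v∈P cv = [ VP∩C≡∅ v∈P , (λ v∈X → C-R c∈C (x∈p∩q⁺ (v∈X , v∈P)) cv) ]′ (C-closed c∈C cv)

      ∁C⊂⊤ : ∁ C ⊂ ⊤
      ∁C⊂⊤ = (λ _ → ∈⊤) , proj₁ C≢∅ , ∈⊤ , x∈p⇒x∉∁p (proj₂ C≢∅)

      C∪X⊂⊤ : C ∪ X ⊂ ⊤
      C∪X⊂⊤ with all? (_∈? C ∪ X)
      ... | no ¬all = (λ _ → ∈⊤) , proj₁ outside , ∈⊤ , proj₂ outside
        where
          outside : ∃[ v ] v ∉ C ∪ X
          outside = ¬∀⟶∃¬ _ _ (_∈? C ∪ X) ¬all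
      ... | yes all = contradiction (C≢∅′ , reach) cut
        where
          ∁X⊆C : ∁ X ⊆ C
          ∁X⊆C v∈ = x∈p∪q∧x∉q⇒x∈p (all _) (x∈∁p⇒x∉p v∈)
          C≢∅′ : Nonempty (∁ X)
          C≢∅′ = proj₁ C≢∅ , C⊆∁X (proj₂ C≢∅)
          reach : ∀ x y → x ∈ ∁ X → y ∈ ∁ X → Reach G (∁ X) x y
          reach x y x∈ y∈ = Reach-mono C⊆∁X (proj₂ (proj₁ (proj₂ component)) x y (∁X⊆C x∈) (∁X⊆C y∈))

      VP⊆∁C : VP G P ⊆ ∁ C
      VP⊆∁C v∈P = x∉p⇒x∈∁p (VP∩C≡∅ v∈P)

      N[P]-within-∁C : NbhdIn G ⊤ (VP G P) ≡ NbhdIn G (∁ C) (VP G P)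
      N[P]-within-∁C = ⊆-antisym (λ v∈ → Nbhd-restrict VP⊆∁C (x∉p⇒x∈∁p (outside v∈)) v∈)
                                 (NbhdIn-mono {U = ∁ C} {S = VP G P} (λ _ → ∈⊤))
        where
          outside : ∀ {v} → v ∈ Nbhd G (VP G P) → v ∉ C
          outside v∈ v∈C with ∈NbhdIn⁻ ⊤ (VP G P) v∈
          ... | _ , inj₁ v∈P = VP∩C≡∅ v∈P v∈C
          ... | _ , inj₂ (w , _ , w∈P , vw) = C-VP v∈C w∈P vw

      admissible-∁C : Admissible G (∁ C) P W₁ W₂
      admissible-∁C = chordal-W₁ , chordal-W₂ , W₁∩W₂ , trans W₁∪W₂ N[P]-within-∁C

      Q : SmallPath G
      Q = proj₁ (SmallPath-∩ P X R≢∅)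

      VQ≡R : VP G Q ≡ R
      VQ≡R = proj₂ (SmallPath-∩ P X R≢∅)

      VQ⊆R : VP G Q ⊆ R
      VQ⊆R v∈ = subst (_ ∈_) VQ≡R v∈

      R⊆VQ : R ⊆ VP G Q
      R⊆VQ v∈ = subst (_ ∈_) (sym VQ≡R) v∈

      VQ⊆X : VP G Q ⊆ X
      VQ⊆X v∈ = proj₁ (x∈p∩q⁻ X _ (VQ⊆R v∈))

      VQ⊆VP : VP G Q ⊆ VP G P
      VQ⊆VP v∈ = proj₂ (x∈p∩q⁻ X _ (VQ⊆R v∈))

      X⊆N[Q] : X ⊆ Nbhd G (VP G Q)
      X⊆N[Q] = subst (λ S → X ⊆ Nbhd G S) (sym VQ≡R) X⊆N[R]

      VQ⊆C∪X : VP G Q ⊆ C ∪ X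
      VQ⊆C∪X v∈ = x∈p∪q⁺ (inj₂ (VQ⊆X v∈))

      module Inside {Y₁ Y₂ : Subset n} (Y₁∩Y₂ : Y₁ ∩ Y₂ ≡ VP G P) (Y₁∪Y₂ : Y₁ ∪ Y₂ ≡ ∁ C) where

        VP⊆Y₁ : VP G P ⊆ Y₁
        VP⊆Y₁ v∈ = proj₁ (x∈p∩q⁻ Y₁ Y₂ (subst (_ ∈_) (sym Y₁∩Y₂) v∈))

        VP⊆Y₂ : VP G P ⊆ Y₂
        VP⊆Y₂ v∈ = proj₂ (x∈p∩q⁻ Y₁ Y₂ (subst (_ ∈_) (sym Y₁∩Y₂) v∈))

        Y₁∩C≡∅ : ∀ {v} → v ∈ Y₁ → v ∉ C
        Y₁∩C≡∅ v∈ = x∈∁p⇒x∉p (subst (_ ∈_) Y₁∪Y₂ (x∈p∪q⁺ (inj₁ v∈)))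

        Y₂∩C≡∅ : ∀ {v} → v ∈ Y₂ → v ∉ C
        Y₂∩C≡∅ v∈ = x∈∁p⇒x∉p (subst (_ ∈_) Y₁∪Y₂ (x∈p∪q⁺ (inj₂ v∈)))

        outside-C : ∀ {v} → v ∉ C → v ∈ Y₁ ⊎ v ∈ Y₂
        outside-C v∉C = x∈p∪q⁻ Y₁ Y₂ (subst (_ ∈_) (sym Y₁∪Y₂) (x∉p⇒x∈∁p v∉C))

        admissible-C∪X : Chordal G Y₁ → Chordal G Y₂ → Admissible G (C ∪ X) Q (Y₁ ∩ X) (Y₂ ∩ X)
        admissible-C∪X chordal-Y₁ chordal-Y₂ =
          Chordal-anti (p∩q⊆p Y₁ X) chordal-Y₁ , Chordal-anti (p∩q⊆p Y₂ X) chordal-Y₂ ,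
          ⊆-antisym meet⊆ ⊆meet , ⊆-antisym join⊆ ⊆join
          where
            meet⊆ : (Y₁ ∩ X) ∩ (Y₂ ∩ X) ⊆ VP G Q
            meet⊆ v∈ with x∈p∩q⁻ (Y₁ ∩ X) _ v∈
            ... | v∈₁ , v∈₂ = R⊆VQ (x∈p∩q⁺ (proj₂ (x∈p∩q⁻ Y₁ X v∈₁) ,
                    subst (_ ∈_) Y₁∩Y₂ (x∈p∩q⁺ (proj₁ (x∈p∩q⁻ Y₁ X v∈₁) , proj₁ (x∈p∩q⁻ Y₂ X v∈₂)))))
            ⊆meet : VP G Q ⊆ (Y₁ ∩ X) ∩ (Y₂ ∩ X)
            ⊆meet v∈ = x∈p∩q⁺ (x∈p∩q⁺ (VP⊆Y₁ (VQ⊆VP v∈) , VQ⊆X v∈) , x∈p∩q⁺ (VP⊆Y₂ (VQ⊆VP v∈) , VQ⊆X v∈))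
            join⊆ : (Y₁ ∩ X) ∪ (Y₂ ∩ X) ⊆ NbhdIn G (C ∪ X) (VP G Q)
            join⊆ {v} v∈ = Nbhd-restrict VQ⊆C∪X (x∈p∪q⁺ (inj₂ v∈X)) (X⊆N[Q] v∈X)
              where
                v∈X : v ∈ X
                v∈X = [ (λ v∈₁ → proj₂ (x∈p∩q⁻ Y₁ X v∈₁)) , (λ v∈₂ → proj₂ (x∈p∩q⁻ Y₂ X v∈₂)) ]′
                        (x∈p∪q⁻ (Y₁ ∩ X) _ v∈)
            ⊆join : NbhdIn G (C ∪ X) (VP G Q) ⊆ (Y₁ ∩ X) ∪ (Y₂ ∩ X)
            ⊆join {v} v∈ with ∈NbhdIn⁻ (C ∪ X) (VP G Q) v∈
            ... | v∈C∪X , near = x∈p∪q⁺ (Data.Sum.map (λ v∈₁ → x∈p∩q⁺ (v∈₁ , v∈X)) (λ v∈₂ → x∈p∩q⁺ (v∈₂ , v∈X))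
                                                      (outside-C v∉C))
              where
                v∉C : v ∉ C
                v∉C v∈C = [ (λ v∈Q → C∩X≡∅ v∈C (VQ⊆X v∈Q))
                          , (λ { (w , _ , w∈Q , vw) → C-VP v∈C (VQ⊆VP w∈Q) vw }) ]′ near
                v∈X : v ∈ X
                v∈X = x∈p∪q∧x∉p⇒x∈q v∈C∪X v∉C

        module Glue {Z₁ Z₂ : Subset n} (Y₁∩X⊆Z₁ : Y₁ ∩ X ⊆ Z₁) (Y₂∩X⊆Z₂ : Y₂ ∩ X ⊆ Z₂)
                    (Z₁∩Z₂ : Z₁ ∩ Z₂ ≡ VP G Q) (Z₁∪Z₂ : Z₁ ∪ Z₂ ≡ C ∪ X) where

          private
            Z₁∩Z₂⊆VP : ∀ {v} → v ∈ Z₁ → v ∈ Z₂ → v ∈ VP G P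
            Z₁∩Z₂⊆VP v∈₁ v∈₂ = VQ⊆VP (subst (_ ∈_) Z₁∩Z₂ (x∈p∩q⁺ (v∈₁ , v∈₂)))

            VQ⊆Z₁ : VP G Q ⊆ Z₁
            VQ⊆Z₁ v∈ = proj₁ (x∈p∩q⁻ Z₁ Z₂ (subst (_ ∈_) (sym Z₁∩Z₂) v∈))

            VQ⊆Z₂ : VP G Q ⊆ Z₂
            VQ⊆Z₂ v∈ = proj₂ (x∈p∩q⁻ Z₁ Z₂ (subst (_ ∈_) (sym Z₁∩Z₂) v∈))

            Z₁⊆C∪X : ∀ {v} → v ∈ Z₁ → v ∈ C ⊎ v ∈ X
            Z₁⊆C∪X v∈ = x∈p∪q⁻ C X (subst (_ ∈_) Z₁∪Z₂ (x∈p∪q⁺ (inj₁ v∈)))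

            Z₂⊆C∪X : ∀ {v} → v ∈ Z₂ → v ∈ C ⊎ v ∈ X
            Z₂⊆C∪X v∈ = x∈p∪q⁻ C X (subst (_ ∈_) Z₁∪Z₂ (x∈p∪q⁺ (inj₂ v∈)))

            Z₁∩X⊆Y₁ : ∀ {v} → v ∈ Z₁ → v ∈ X → v ∈ Y₁
            Z₁∩X⊆Y₁ v∈Z₁ v∈X =
              [ (λ v∈Y₁ → v∈Y₁) , (λ v∈Y₂ → VP⊆Y₁ (Z₁∩Z₂⊆VP v∈Z₁ (Y₂∩X⊆Z₂ (x∈p∩q⁺ (v∈Y₂ , v∈X))))) ]′
                (outside-C (λ v∈C → C∩X≡∅ v∈C v∈X))

            Z₂∩X⊆Y₂ : ∀ {v} → v ∈ Z₂ → v ∈ X → v ∈ Y₂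
            Z₂∩X⊆Y₂ v∈Z₂ v∈X =
              [ (λ v∈Y₁ → VP⊆Y₂ (Z₁∩Z₂⊆VP (Y₁∩X⊆Z₁ (x∈p∩q⁺ (v∈Y₁ , v∈X))) v∈Z₂)) , (λ v∈Y₂ → v∈Y₂) ]′
                (outside-C (λ v∈C → C∩X≡∅ v∈C v∈X))

            join : ∀ {x y} → x ∈ X → y ∈ X → x ≢ y → ¬ Adj G x y → InducedPath (VP G Q) y x
            join x∈X y∈X = clique-path (VP-clique Q) (X⊆N[Q] x∈X) (X⊆N[Q] y∈X)

            VQ∩C≡∅ : ∀ {v} → v ∈ VP G Q → v ∉ C
            VQ∩C≡∅ v∈Q v∈C = C∩X≡∅ v∈C (VQ⊆X v∈Q)

            C-VQ : ∀ {c v} → c ∈ C → v ∈ VP G Q → ¬ Adj G c v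
            C-VQ c∈C v∈Q = C-VP c∈C (VQ⊆VP v∈Q)

          chordal₁ : Chordal G Y₁ → Chordal G Z₁ → Chordal G (Y₁ ∪ Z₁)
          chordal₁ = Gluing.chordal-∪ C-closed VQ∩C≡∅ C-VQ join Y₁∩C≡∅ Z₁⊆C∪X
                       (λ v∈Y v∈X → Y₁∩X⊆Z₁ (x∈p∩q⁺ (v∈Y , v∈X))) Z₁∩X⊆Y₁ VQ⊆Z₁

          chordal₂ : Chordal G Y₂ → Chordal G Z₂ → Chordal G (Y₂ ∪ Z₂)
          chordal₂ = Gluing.chordal-∪ C-closed VQ∩C≡∅ C-VQ join Y₂∩C≡∅ Z₂⊆C∪X
                       (λ v∈Y v∈X → Y₂∩X⊆Z₂ (x∈p∩q⁺ (v∈Y , v∈X))) Z₂∩X⊆Y₂ VQ⊆Z₂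

          meet : (Y₁ ∪ Z₁) ∩ (Y₂ ∪ Z₂) ≡ VP G P
          meet = ⊆-antisym meet⊆ (λ v∈ → x∈p∩q⁺ (x∈p∪q⁺ (inj₁ (VP⊆Y₁ v∈)) , x∈p∪q⁺ (inj₁ (VP⊆Y₂ v∈))))
            where
              cases : ∀ {v} → v ∈ Y₁ ⊎ v ∈ Z₁ → v ∈ Y₂ ⊎ v ∈ Z₂ → v ∈ VP G P
              cases (inj₁ v∈Y₁) (inj₁ v∈Y₂) = subst (_ ∈_) Y₁∩Y₂ (x∈p∩q⁺ (v∈Y₁ , v∈Y₂))
              cases (inj₂ v∈Z₁) (inj₂ v∈Z₂) = Z₁∩Z₂⊆VP v∈Z₁ v∈Z₂
              cases (inj₁ v∈Y₁) (inj₂ v∈Z₂) =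
                Z₁∩Z₂⊆VP (Y₁∩X⊆Z₁ (x∈p∩q⁺ (v∈Y₁ , resolve-inj₂ (Y₁∩C≡∅ v∈Y₁) (Z₂⊆C∪X v∈Z₂)))) v∈Z₂
              cases (inj₂ v∈Z₁) (inj₁ v∈Y₂) =
                Z₁∩Z₂⊆VP v∈Z₁ (Y₂∩X⊆Z₂ (x∈p∩q⁺ (v∈Y₂ , resolve-inj₂ (Y₂∩C≡∅ v∈Y₂) (Z₁⊆C∪X v∈Z₁))))
              meet⊆ : (Y₁ ∪ Z₁) ∩ (Y₂ ∪ Z₂) ⊆ VP G P
              meet⊆ v∈ with x∈p∩q⁻ (Y₁ ∪ Z₁) _ v∈
              ... | v∈₁ , v∈₂ = cases (x∈p∪q⁻ Y₁ Z₁ v∈₁) (x∈p∪q⁻ Y₂ Z₂ v∈₂)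

          cover : (Y₁ ∪ Z₁) ∪ (Y₂ ∪ Z₂) ≡ ⊤
          cover = ⊆-antisym (λ _ → ∈⊤) ⊤⊆
            where
              ⊤⊆ : ⊤ ⊆ (Y₁ ∪ Z₁) ∪ (Y₂ ∪ Z₂)
              ⊤⊆ {v} _ with v ∈? C
              ... | yes v∈C = x∈p∪q⁺ (Data.Sum.map (λ v∈Z₁ → x∈p∪q⁺ (inj₂ v∈Z₁)) (λ v∈Z₂ → x∈p∪q⁺ (inj₂ v∈Z₂))
                                (x∈p∪q⁻ Z₁ Z₂ (subst (_ ∈_) (sym Z₁∪Z₂) (x∈p∪q⁺ (inj₁ v∈C)))))
              ... | no v∉C  = x∈p∪q⁺ (Data.Sum.map (λ v∈Y₁ → x∈p∪q⁺ (inj₁ v∈Y₁)) (λ v∈Y₂ → x∈p∪q⁺ (inj₁ v∈Y₂))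
                                (outside-C v∉C))

    extends : Extends G ⊤ P W₁ W₂
    extends with minimal (∁ C) ∁C⊂⊤ P VP⊆∁C W₁ W₂ admissible-∁C
    ... | Y₁ , Y₂ , W₁⊆Y₁ , W₂⊆Y₂ , chordal-Y₁ , chordal-Y₂ , Y₁∩Y₂ , Y₁∪Y₂
        with minimal (C ∪ X) C∪X⊂⊤ Q VQ⊆C∪X (Y₁ ∩ X) (Y₂ ∩ X)
               (Inside.admissible-C∪X Y₁∩Y₂ Y₁∪Y₂ chordal-Y₁ chordal-Y₂)
    ...   | Z₁ , Z₂ , Y₁∩X⊆Z₁ , Y₂∩X⊆Z₂ , chordal-Z₁ , chordal-Z₂ , Z₁∩Z₂ , Z₁∪Z₂ =
            Y₁ ∪ Z₁ , Y₂ ∪ Z₂ ,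
            (λ w∈ → x∈p∪q⁺ (inj₁ (W₁⊆Y₁ w∈))) , (λ w∈ → x∈p∪q⁺ (inj₁ (W₂⊆Y₂ w∈))) ,
            glue.chordal₁ chordal-Y₁ chordal-Z₁ , glue.chordal₂ chordal-Y₂ chordal-Z₂ , glue.meet , glue.cover
      where module glue = Inside.Glue Y₁∩Y₂ Y₁∪Y₂ Y₁∩X⊆Z₁ Y₂∩X⊆Z₂ Z₁∩Z₂ Z₁∪Z₂

lemma5p6 : (G : Graph) (P : SmallPath G) (W₁ W₂ X : Subset (Graph.n G)) →
    MinimalNonWeaklyFPE G → WitnessPath G P W₁ W₂ → Cutset G X →
    Connected G (X ∩ VP G P) → X ⊆ Nbhd G (X ∩ VP G P) →
    ∀ (C : Subset (Graph.n G)) → Component G (∁ X) C →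
    Σ (Fin (Graph.n G)) λ c → c ∈ C × Σ (Fin (Graph.n G)) λ p → p ∈ X ∩ VP G P × Adj G c p
lemma5p6 G P W₁ W₂ X (_ , minimal) ((chordal-W₁ , chordal-W₂ , W₁∩W₂ , W₁∪W₂) , no-extension)
         cut (R≢∅ , _) X⊆N[R] C component
  with any? (λ c → c ∈? C ×-dec any? (λ p → p ∈? X ∩ VP G P ×-dec Adj? G c p))
... | yes found = found
... | no none = ⊥-elim (no-extension (UnattachedComponent.extends G P minimal
    chordal-W₁ chordal-W₂ W₁∩W₂ W₁∪W₂ cut R≢∅ X⊆N[R] component
    (λ c∈C p∈R cp → none (_ , c∈C , _ , p∈R , cp))))
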